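{- Let \(\vec G\) be an oriented graph and \(a\in A_{\vec G}\). Let \(\vec G_a\) be the oriented graph obtained from \(\vec G\) by reversing the orientation of \(a\), and \(\vec G-a\) the oriented graph obtained by removing \(a\). If \(\vec G\) and \(\vec G_a\) are both complete convex, then \(\vec G-a\) is complete convex.
   Context: Oriented graphs: anti-symmetric digraphs without parallel arcs. A \(2\)-dipath \(u,v,w\) with centre \(v\): \(uv,vw\) arcs, \(u\ne v\ne w\). A vertex set \(S\) is convex if no vertex outside \(S\) is the centre of a \(2\)-dipath with both ends in \(S\); \(conv(S)\) is the smallest convex superset of \(S\). An oriented graph is complete convex if \(conv(\{u,v\})\) is the whole vertex set for every arc \(uv\). -}

module Defs where

open import Data.Nat using (ℕ)
open import Data.Fin using (Fin)
open import Data.Product using (_×_)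
open import Data.Sum using (_⊎_)
open import Data.Empty using (⊥)
open import Relation.Nullary using (¬_)
open import Relation.Binary.PropositionalEquality using (_≡_; _≢_)
open import Level using (0ℓ; suc)

record OrientedGraph (n : ℕ) : Set₁ where
  field
    Arc      : Fin n → Fin n → Set
    irrefl   : ∀ u → ¬ Arc u u
    antisym  : ∀ u v → Arc u v → ¬ Arc v u

open OrientedGraph public

VSet : ℕ → Set₁
VSet n = Fin n → Set

Convex : ∀ {n} → OrientedGraph n → VSet n → Set
Convex G S = ∀ u v w → u ≢ v → v ≢ w → u ≢ w →
  Arc G u v → Arc G v w → S u → S w → S v

Conv : ∀ {n} → OrientedGraph n → VSet n → Fin n → Set₁
Conv G S x = (T : VSet _) → Convex G T → (∀ y → S y → T y) → T x

Pair : ∀ {n} → Fin n → Fin n → VSet n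
Pair u v x = (x ≡ u) ⊎ (x ≡ v)

CompleteConvex : ∀ {n} → OrientedGraph n → Set₁
CompleteConvex G = ∀ u v → Arc G u v → ∀ x → Conv G (Pair u v) x

reverseArc : ∀ {n} (G : OrientedGraph n) (u v : Fin n) → Arc G u v → OrientedGraph n
reverseArc {n} G u v a = record
  { Arc = A'
  ; irrefl = irr
  ; antisym = asym }
  where
  A' : Fin n → Fin n → Set
  A' x y = (Arc G x y × ¬ (x ≡ u × y ≡ v)) ⊎ (x ≡ v × y ≡ u)
  open import Data.Sum using (inj₁; inj₂)
  open import Data.Product using (_,_)
  open import Relation.Binary.PropositionalEquality using (refl)
  irr : ∀ x → ¬ A' x x
  irr x (inj₁ (p , _)) = irrefl G x p
  irr x (inj₂ (refl , refl)) = irrefl G x a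
  asym : ∀ x y → A' x y → ¬ A' y x
  asym x y (inj₁ (p , np)) (inj₁ (q , nq)) = antisym G x y p q
  asym x y (inj₁ (p , np)) (inj₂ (refl , refl)) = np (refl , refl)
  asym x y (inj₂ (refl , refl)) (inj₁ (q , nq)) = nq (refl , refl)
  asym x y (inj₂ (refl , refl)) (inj₂ (refl , refl)) = irrefl G x a

removeArc : ∀ {n} (G : OrientedGraph n) (u v : Fin n) → OrientedGraph n
removeArc {n} G u v = record
  { Arc = A'
  ; irrefl = λ x p → irrefl G x (proj₁ p)
  ; antisym = λ x y p q → antisym G x y (proj₁ p) (proj₁ q) }
  where
  open import Data.Product using (proj₁)
  A' : Fin n → Fin n → Set
  A' x y = Arc G x y × ¬ (x ≡ u × y ≡ v)

module Submission where

open import Defs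
open import Data.Nat using (ℕ)
open import Data.Fin using (Fin)
open import Data.Fin.Properties using (_≟_)
open import Data.Product using (_×_; _,_; Σ-syntax)
open import Data.Sum using (_⊎_; inj₁; inj₂; reduce)
open import Data.Empty using (⊥-elim)
open import Function using (_∘_)
open import Relation.Nullary using (yes; no)
open import Relation.Nullary.Decidable using (_×-dec_)
open import Relation.Binary.PropositionalEquality using (_≢_; refl; sym)

-- Let T be convex in G − uv and contain both ends of an arc of G − uv. The only
-- 2-dipaths of G or Gₐ that are not in G − uv pass through uv or vu, and a case
-- analysis on which of u, v lie in T shows that T is convex in G or in Gₐ; the delicate
-- case is u ∈ T, v ∉ T with some v → q, q ∈ T, where any p → v, p ∈ T, would put v in T
-- by convexity in G − uv, so Gₐ works. Complete convexity of that graph then gives T = V.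
-- Membership in T is undecidable, so the case analysis is run with answer type T z on
-- the set T ∪ {all vertices, if T z}, which is still convex.

excluded-middle-with : {A R : Set} → ((A ⊎ (A → R)) → R) → R
excluded-middle-with k = k (inj₂ (λ x → k (inj₁ x)))

module _ {n : ℕ} (G : OrientedGraph n) where

  dipath-distinct : ∀ {p c q} → Arc G p c → Arc G c q → p ≢ c × c ≢ q × p ≢ q
  dipath-distinct {p} pc cq = (λ { refl → irrefl G p pc })
                            , (λ { refl → irrefl G _ cq })
                            , (λ { refl → antisym G p _ pc cq })

  convex-along : ∀ {S p c q} → Convex G S → Arc G p c → Arc G c q → S p → S q → S c
  convex-along {p = p} {c} {q} convex pc cq =
    let (p≢c , c≢q , p≢q) = dipath-distinct pc cq in convex p c q p≢c c≢q p≢q pc cq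

  convex-∪-const : ∀ {S : VSet n} (R : Set) → Convex G S → Convex G (λ w → S w ⊎ R)
  convex-∪-const _ convex p c q p≢c c≢q p≢q pc cq (inj₁ sp) (inj₁ sq) =
    inj₁ (convex p c q p≢c c≢q p≢q pc cq sp sq)
  convex-∪-const _ _ _ _ _ _ _ _ _ _ (inj₂ r) _ = inj₂ r
  convex-∪-const _ _ _ _ _ _ _ _ _ _ _ (inj₂ r) = inj₂ r

module _ {n : ℕ} (G : OrientedGraph n) (u v : Fin n) (a : Arc G u v) where

  private
    G-a : OrientedGraph n
    G-a = removeArc G u v

    Gₐ : OrientedGraph n
    Gₐ = reverseArc G u v a

    u≢v : u ≢ v
    u≢v refl = irrefl G u a

  arc-from-head : ∀ {q} → Arc G v q → Arc G-a v q
  arc-from-head vq = vq , λ { (v≡u , _) → u≢v (sym v≡u) }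

  arc-into-tail : ∀ {p} → Arc G p u → Arc G-a p u
  arc-into-tail pu = pu , λ { (_ , u≡v) → u≢v u≡v }

  convex-removeArc⇒convex : ∀ {S : VSet n} → Convex G-a S →
    (∀ q → Arc G v q → S u → S q → S v) →
    (∀ p → Arc G p u → S p → S v → S u) →
    Convex G S
  convex-removeArc⇒convex convex through-head through-tail p c q p≢c c≢q p≢q pc cq sp sq
    with (p ≟ u ×-dec c ≟ v) | (c ≟ u ×-dec q ≟ v)
  ... | yes (refl , refl) | _ = through-head q cq sp sq
  ... | no _ | yes (refl , refl) = through-tail p pc sp sq
  ... | no pc≢uv | no cq≢uv = convex p c q p≢c c≢q p≢q (pc , pc≢uv) (cq , cq≢uv) sp sq

  convex-removeArc⇒convex-reversed : ∀ {S : VSet n} → Convex G-a S →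
    (∀ p → Arc G-a p v → S p → S u → S v) →
    (∀ w → Arc G-a u w → S v → S w → S u) →
    Convex Gₐ S
  convex-removeArc⇒convex-reversed convex _ _ p c q p≢c c≢q p≢q (inj₁ pc) (inj₁ cq) =
    convex p c q p≢c c≢q p≢q pc cq
  convex-removeArc⇒convex-reversed _ into-head _ p _ _ _ _ _ (inj₁ pv) (inj₂ (refl , refl)) =
    into-head p pv
  convex-removeArc⇒convex-reversed _ _ from-tail _ _ w _ _ _ (inj₂ (refl , refl)) (inj₁ uw) =
    from-tail w uw
  convex-removeArc⇒convex-reversed _ _ _ _ _ _ _ _ _ (inj₂ (refl , refl)) (inj₂ (u≡v , _)) =
    ⊥-elim (u≢v u≡v)

  convex-removeArc⇒convex-or-reversed : ∀ {S : VSet n} {R : Set} → Convex G-a S → (∀ w → R → S w) →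
    (Convex G S → R) → (Convex Gₐ S → R) → R
  convex-removeArc⇒convex-or-reversed {S} {R} convex R⇒S in-G in-Gₐ =
    excluded-middle-with λ
      { (inj₁ su) → excluded-middle-with λ
          { (inj₁ sv) → in-G (convex-removeArc⇒convex convex (λ _ _ _ _ → sv) (λ _ _ _ _ → su))
          ; (inj₂ ¬sv) → u-in-v-out su ¬sv }
      ; (inj₂ ¬su) → excluded-middle-with λ
          { (inj₁ sv) → u-out-v-in ¬su sv
          ; (inj₂ ¬sv) → in-G (convex-removeArc⇒convex convex
              (λ _ _ su _ → R⇒S v (¬su su)) (λ _ _ _ sv → R⇒S u (¬sv sv))) } }
    where
    u-in-v-out : S u → (S v → R) → R
    u-in-v-out su ¬sv = excluded-middle-with {Σ[ q ∈ Fin n ] Arc G v q × S q} λ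
      { (inj₁ (q , vq , sq)) → in-Gₐ (convex-removeArc⇒convex-reversed convex
          (λ p pv sp _ → convex-along G-a convex pv (arc-from-head vq) sp sq)
          (λ _ _ _ _ → su))
      ; (inj₂ no-out-neighbour-of-v) → in-G (convex-removeArc⇒convex convex
          (λ q vq _ sq → R⇒S v (no-out-neighbour-of-v (q , vq , sq)))
          (λ _ _ _ _ → su)) }

    u-out-v-in : (S u → R) → S v → R
    u-out-v-in ¬su sv = excluded-middle-with {Σ[ p ∈ Fin n ] Arc G p u × S p} λ
      { (inj₁ (p , pu , sp)) → in-Gₐ (convex-removeArc⇒convex-reversed convex
          (λ _ _ _ _ → sv)
          (λ w uw _ sw → convex-along G-a convex (arc-into-tail pu) uw sp sw))
      ; (inj₂ no-in-neighbour-of-u) → in-G (convex-removeArc⇒convex convex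
          (λ _ _ _ _ → sv)
          (λ p pu sp _ → R⇒S u (no-in-neighbour-of-u (p , pu , sp)))) }

theorem10 : ∀ {n} (G : OrientedGraph n) (u v : Fin n) (a : Arc G u v) →
    CompleteConvex G → CompleteConvex (reverseArc G u v a) →
    CompleteConvex (removeArc G u v)
theorem10 G u v a complete completeₐ x y xy@(xyᴳ , _) z T convex xy⊆T =
  convex-removeArc⇒convex-or-reversed G u v a (convex-∪-const (removeArc G u v) (T z) convex)
    (λ _ → inj₂)
    (λ convexᴳ → reduce (complete x y xyᴳ z _ convexᴳ (λ w → inj₁ ∘ xy⊆T w)))
    (λ convexₐ → reduce (completeₐ x y (inj₁ xy) z _ convexₐ (λ w → inj₁ ∘ xy⊆T w)))
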